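{- Let $D$ be a loose multipartite tournament, let $X$ be a partite set of $D$ that is not $\{1,2\}$-competing, and suppose $C_{1,2}(D)$ has a hole $H=v_0v_1v_2v_3v_0$ of length four. Then: (1) either (i) $X$ is the only partite set of $D$ that is not $\{1,2\}$-competing, or (ii) $|X|\ge 4$ and there is exactly one partite set of $D$ other than $X$ that is not $\{1,2\}$-competing, and it has size at least four; (2) (i) if $v_0$ and $v_2$ lie in distinct partite sets of $D$, then $N^+(v_0)=\{v_2\}$ or $N^+(v_2)=\{v_0\}$; likewise, if $v_1$ and $v_3$ lie in distinct partite sets, then $N^+(v_1)=\{v_3\}$ or $N^+(v_3)=\{v_1\}$; (ii) if $v_0,v_2$ lie in a common partite set and $v_1,v_3$ lie in a common partite set, then $D$ has a partite set of size at least four.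
   Context: All graphs and digraphs are finite and simple. For a digraph $D$ and vertex $v$, $N^+(v)$ is its out-neighborhood; $d_D(x,y)$ is the length of a shortest directed path from $x$ to $y$. The $(1,2)$-step competition graph $C_{1,2}(D)$ is the graph on $V(D)$ in which distinct $u,v$ are adjacent iff there is a vertex $w\notin\{u,v\}$ with either $d_{D-v}(u,w)\le 1$ and $d_{D-u}(v,w)\le 2$, or $d_{D-u}(v,w)\le 1$ and $d_{D-v}(u,w)\le 2$. A multipartite tournament is an orientation of a complete $k$-partite graph for some $k\ge3$ (with nonempty partite sets). A set of vertices is $\{1,2\}$-competing if it is a clique in $C_{1,2}(D)$. A multipartite tournament is loose if some partite set is not $\{1,2\}$-competing. A hole of a graph is an induced cycle of length at least four. -}

module Defs where

open import Data.Nat using (ℕ; _≤_)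
open import Data.Fin using (Fin; _≟_)
open import Data.Fin.Base using ()
open import Data.List using (List; length; filter)
open import Data.List.Base using (allFin)
open import Data.Bool using (Bool; true)
open import Data.Product using (Σ; _×_; ∃)
open import Data.Sum using (_⊎_)
open import Data.Empty using (⊥)
open import Relation.Nullary using (¬_)
open import Relation.Binary.PropositionalEquality using (_≡_; _≢_)

record MPT (n k : ℕ) : Set where
  field
    part      : Fin n → Fin k
    arc       : Fin n → Fin n → Bool
    three≤k   : 3 ≤ k
    nonempty  : ∀ (i : Fin k) → ∃ λ v → part v ≡ i
    sameNoArc : ∀ u v → part u ≡ part v → ¬ (arc u v ≡ true)
    diffArc   : ∀ u v → part u ≢ part v → (arc u v ≡ true) ⊎ (arc v u ≡ true)
    noDigon   : ∀ u v → arc u v ≡ true → arc v u ≡ true → ⊥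

module _ {n k : ℕ} (D : MPT n k) where
  open MPT D

  Arc : Fin n → Fin n → Set
  Arc u v = arc u v ≡ true

  -- d_{D-u}(v,w) ≤ 2 (for v ≠ w, v,w ≠ u): a directed path of length ≤ 2 from v to w avoiding u
  Reach≤2Avoiding : Fin n → Fin n → Fin n → Set
  Reach≤2Avoiding u v w = Arc v w ⊎ Σ (Fin n) (λ x → x ≢ u × Arc v x × Arc x w)

  C12Adj : Fin n → Fin n → Set
  C12Adj u v = u ≢ v × Σ (Fin n) (λ w → w ≢ u × w ≢ v ×
                 ((Arc u w × Reach≤2Avoiding u v w) ⊎ (Arc v w × Reach≤2Avoiding v u w)))

  Competing : Fin k → Set
  Competing i = ∀ u v → part u ≡ i → part v ≡ i → u ≢ v → C12Adj u v

  Loose : Set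
  Loose = Σ (Fin k) (λ i → ¬ Competing i)

  partSize : Fin k → ℕ
  partSize i = length (filter (λ v → part v ≟ i) (allFin n))

  OutNbhdSingleton : Fin n → Fin n → Set
  OutNbhdSingleton v w = Arc v w × (∀ x → Arc v x → x ≡ w)

  Hole4 : Fin n → Fin n → Fin n → Fin n → Set
  Hole4 v0 v1 v2 v3 =
    v0 ≢ v1 × v0 ≢ v2 × v0 ≢ v3 × v1 ≢ v2 × v1 ≢ v3 × v2 ≢ v3 ×
    C12Adj v0 v1 × C12Adj v1 v2 × C12Adj v2 v3 × C12Adj v3 v0 ×
    ¬ C12Adj v0 v2 × ¬ C12Adj v1 v3

-- Two facts about distinct vertices c, d of one partite set that are nonadjacent in C_{1,2}(D)
-- drive everything: every vertex outside their partite set has an arc into {c, d}, and all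
-- out-neighbours of c and d lie in one partite set, since an arc between two of them would be a
-- 2-step witness of adjacency.  With such pairs in two partite sets X ≠ Y, the out-neighbours of
-- the pair in X therefore lie in Y, and every vertex of any nonadjacent pair lies in X ∪ Y; in
-- particular no third partite set fails to be {1,2}-competing.
-- In the hole, an arc v0 → v2 leaves v0 no second out-neighbour, for otherwise v1 and v3 would
-- both send arcs into {v0, v2} and be adjacent.  If {v0, v2} and {v1, v3} lie in two different
-- partite sets, the hole is a directed 4-cycle, and v0, v2 each have one more out-neighbour in
-- the partite set of v1, v3.  For (1), no opposite pair of the hole is split between X and Y,
-- and each remaining placement yields four vertices of X: the hole itself, the 4-cycle argument,
-- or a nonadjacent pair of X together with common out-neighbours of two opposite hole edges.

module Submission where

open import Defs
open import Data.Bool using (true)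
import Data.Bool.Properties as Bool
open import Data.Fin using (Fin; _≟_)
open import Data.Fin.Properties using (injective⇒≤; any?; all?)
open import Data.List using (List; length)
import Data.List as List
open import Data.List.Membership.Propositional using (_∈_)
open import Data.List.Membership.Propositional.Properties using (∈-filter⁺; ∈-allFin)
open import Data.List.Relation.Unary.Any using (index)
open import Data.List.Relation.Unary.Any.Properties using (lookup-index)
open import Data.Nat using (ℕ; _≤_)
open import Data.Product using (Σ; ∃; ∃₂; _×_; _,_; proj₁; proj₂)
open import Data.Sum using (_⊎_; inj₁; inj₂; [_,_]′)
import Data.Sum as Sum
open import Data.Vec using (Vec; []; _∷_; lookup)
open import Data.Vec.Relation.Unary.All using (All; []; _∷_)
open import Data.Vec.Relation.Unary.All.Properties using (lookup⁺)
open import Data.Vec.Relation.Unary.AllPairs using ([]; _∷_)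
open import Data.Vec.Relation.Unary.Unique.Propositional using (Unique)
open import Data.Vec.Relation.Unary.Unique.Propositional.Properties using (lookup-injective)
open import Data.Empty using (⊥; ⊥-elim)
open import Function using (_∘_; flip; id)
open import Relation.Nullary using (¬_; Dec; yes; no)
open import Relation.Nullary.Decidable using (_×-dec_; _⊎-dec_; _→-dec_; ¬?; decidable-stable)
open import Relation.Binary.PropositionalEquality
  using (_≡_; _≢_; refl; sym; trans; cong; subst; ≢-sym; module ≡-Reasoning)

Unique⇒length≤ : ∀ {a} {A : Set a} {m} {xs : Vec A m} {ys : List A} →
                 Unique xs → (∀ i → lookup xs i ∈ ys) → m ≤ length ys
Unique⇒length≤ {xs = xs} {ys} xs! xs⊆ys = injective⇒≤ λ {i} {j} eq →
  lookup-injective xs! i j (begin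
    lookup xs i                       ≡⟨ lookup-index (xs⊆ys i) ⟩
    List.lookup ys (index (xs⊆ys i))  ≡⟨ cong (List.lookup ys) eq ⟩
    List.lookup ys (index (xs⊆ys j))  ≡⟨ lookup-index (xs⊆ys j) ⟨
    lookup xs j                       ∎)
  where open ≡-Reasoning

module _ {n k : ℕ} (D : MPT n k) where
  open MPT D

  private variable
    m : ℕ
    i X Y : Fin k
    a b c d p q p' q' u v w x y z h0 h1 h2 h3 : Fin n

  infix 4 _⟶_ _~_ _≁_

  _⟶_ : Fin n → Fin n → Set
  _⟶_ = Arc D

  _~_ : Fin n → Fin n → Set
  _~_ = C12Adj D

  _≁_ : Fin n → Fin n → Set
  u ≁ v = ¬ u ~ v

  N⁺_⊆_ : Fin n → Fin k → Set
  N⁺ v ⊆ i = ∀ {z} → v ⟶ z → part z ≡ i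

  Unique⇒≤partSize : {xs : Vec (Fin n) m} → Unique xs → All (λ v → part v ≡ i) xs → m ≤ partSize D i
  Unique⇒≤partSize {i = i} xs! xs⊆i =
    Unique⇒length≤ xs! λ j → ∈-filter⁺ (λ v → part v ≟ i) (∈-allFin _) (lookup⁺ xs⊆i j)

  _⟶?_ : ∀ u v → Dec (u ⟶ v)
  u ⟶? v = arc u v Bool.≟ true

  ⟶⇒part≢ : u ⟶ v → part u ≢ part v
  ⟶⇒part≢ u⟶v eq = sameNoArc _ _ eq u⟶v

  ⟶⇒≢ : u ⟶ v → u ≢ v
  ⟶⇒≢ u⟶v refl = ⟶⇒part≢ u⟶v refl

  ⟶-asym : u ⟶ v → ¬ v ⟶ u
  ⟶-asym = noDigon _ _

  ⟶⟶⇒≢ : u ⟶ v → v ⟶ w → u ≢ w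
  ⟶⟶⇒≢ u⟶v v⟶w refl = ⟶-asym u⟶v v⟶w

  ¬⟶⇒⟵ : part u ≢ part v → ¬ u ⟶ v → v ⟶ u
  ¬⟶⇒⟵ {u} {v} u∉v ¬u⟶v = [ ⊥-elim ∘ ¬u⟶v , id ]′ (diffArc u v u∉v)

  ¬⟶⇒samePart : ¬ u ⟶ v → ¬ v ⟶ u → part u ≡ part v
  ¬⟶⇒samePart {u} {v} ¬u⟶v ¬v⟶u = decidable-stable (part u ≟ part v) (¬v⟶u ∘ flip ¬⟶⇒⟵ ¬u⟶v)

  ~-sym : u ~ v → v ~ u
  ~-sym (u≢v , w , w≢u , w≢v , inj₁ s) = ≢-sym u≢v , w , w≢v , w≢u , inj₂ s
  ~-sym (u≢v , w , w≢u , w≢v , inj₂ s) = ≢-sym u≢v , w , w≢v , w≢u , inj₁ s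

  ≁-sym : u ≁ v → v ≁ u
  ≁-sym u≁v = u≁v ∘ ~-sym

  commonOut⇒~ : u ≢ v → u ⟶ w → v ⟶ w → u ~ v
  commonOut⇒~ u≢v u⟶w v⟶w = u≢v , _ , ≢-sym (⟶⇒≢ u⟶w) , ≢-sym (⟶⇒≢ v⟶w) , inj₁ (u⟶w , inj₁ v⟶w)

  twoPath⇒~ : u ≢ v → u ⟶ w → v ⟶ x → x ⟶ w → x ≢ u → u ~ v
  twoPath⇒~ u≢v u⟶w v⟶x x⟶w x≢u =
    u≢v , _ , ≢-sym (⟶⇒≢ u⟶w) , ≢-sym (⟶⟶⇒≢ v⟶x x⟶w) , inj₁ (u⟶w , inj₂ (_ , x≢u , v⟶x , x⟶w))

  ~⇒out-neighbour : u ~ v → ∃ λ q → u ⟶ q × q ≢ v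
  ~⇒out-neighbour (_ , w , _ , w≢v , inj₁ (u⟶w , _))                        = w , u⟶w , w≢v
  ~⇒out-neighbour (_ , w , _ , w≢v , inj₂ (_ , inj₁ u⟶w))                   = w , u⟶w , w≢v
  ~⇒out-neighbour (_ , _ , _ , _   , inj₂ (_ , inj₂ (x , x≢v , u⟶x , _))) = x , u⟶x , x≢v

  ~⇒commonOut : u ~ v → N⁺ u ⊆ i → N⁺ v ⊆ i → ∃ λ w → u ⟶ w × v ⟶ w
  ~⇒commonOut (_ , w , _ , _ , inj₁ (u⟶w , inj₁ v⟶w)) _ _ = w , u⟶w , v⟶w
  ~⇒commonOut (_ , w , _ , _ , inj₂ (v⟶w , inj₁ u⟶w)) _ _ = w , u⟶w , v⟶w
  ~⇒commonOut (_ , _ , _ , _ , inj₁ (u⟶w , inj₂ (_ , _ , v⟶x , x⟶w))) u⊆i v⊆i =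
    ⊥-elim (⟶⇒part≢ x⟶w (trans (v⊆i v⟶x) (sym (u⊆i u⟶w))))
  ~⇒commonOut (_ , _ , _ , _ , inj₂ (v⟶w , inj₂ (_ , _ , u⟶x , x⟶w))) u⊆i v⊆i =
    ⊥-elim (⟶⇒part≢ x⟶w (trans (u⊆i u⟶x) (sym (v⊆i v⟶w))))

  ≁⇒out-samePart : c ≢ d → c ≁ d → c ⟶ z → d ⟶ w → z ≢ d → w ≢ c → part z ≡ part w
  ≁⇒out-samePart c≢d c≁d c⟶z d⟶w z≢d w≢c = ¬⟶⇒samePart
    (λ z⟶w → c≁d (~-sym (twoPath⇒~ (≢-sym c≢d) d⟶w c⟶z z⟶w z≢d)))
    (λ w⟶z → c≁d (twoPath⇒~ c≢d c⟶z d⟶w w⟶z w≢c))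

  _~?_ : ∀ u v → Dec (u ~ v)
  u ~? v = ¬? (u ≟ v) ×-dec any? λ w → ¬? (w ≟ u) ×-dec ¬? (w ≟ v) ×-dec
             (u ⟶? w ×-dec reach? u v w ⊎-dec v ⟶? w ×-dec reach? v u w)
    where
    reach? : ∀ u v w → Dec (Reach≤2Avoiding D u v w)
    reach? u v w = v ⟶? w ⊎-dec any? λ x → ¬? (x ≟ u) ×-dec v ⟶? x ×-dec x ⟶? w

  competing? : ∀ i → Dec (Competing D i)
  competing? i = all? λ u → all? λ v → part u ≟ i →-dec part v ≟ i →-dec ¬? (u ≟ v) →-dec u ~? v

  record NonadjacentPair (i : Fin k) (p q : Fin n) : Set where
    field
      p∈i : part p ≡ i
      q∈i : part q ≡ i
      p≢q : p ≢ q
      p≁q : p ≁ q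

  ¬competing⇒pair : ¬ Competing D i → ∃₂ (NonadjacentPair i)
  ¬competing⇒pair {i} ¬competing
    with any? (λ p → any? λ q → part p ≟ i ×-dec part q ≟ i ×-dec ¬? (p ≟ q) ×-dec ¬? (p ~? q))
  ... | yes (p , q , p∈i , q∈i , p≢q , p≁q) =
    p , q , record { p∈i = p∈i ; q∈i = q∈i ; p≢q = p≢q ; p≁q = p≁q }
  ... | no none = ⊥-elim (¬competing λ p q p∈i q∈i p≢q →
    decidable-stable (p ~? q) λ p≁q → none (p , q , p∈i , q∈i , p≢q , p≁q))

  swapPair : NonadjacentPair i p q → NonadjacentPair i q p
  swapPair P = record { p∈i = q∈i ; q∈i = p∈i ; p≢q = ≢-sym p≢q ; p≁q = ≁-sym p≁q }
    where open NonadjacentPair P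

  pair-out-samePart : NonadjacentPair i p q → p ⟶ z → q ⟶ w → part z ≡ part w
  pair-out-samePart P p⟶z q⟶w = ≁⇒out-samePart p≢q p≁q p⟶z q⟶w
    (λ { refl → ⟶⇒part≢ p⟶z (trans p∈i (sym q∈i)) })
    (λ { refl → ⟶⇒part≢ q⟶w (trans q∈i (sym p∈i)) })
    where open NonadjacentPair P

  pair-in : NonadjacentPair i p q → part y ≢ i → y ⟶ p ⊎ y ⟶ q
  pair-in {p = p} {q} {y} P y∉i with y ⟶? p | y ⟶? q
  ... | yes y⟶p | _        = inj₁ y⟶p
  ... | no _     | yes y⟶q = inj₂ y⟶q
  ... | no ¬y⟶p | no ¬y⟶q = ⊥-elim (p≁q (commonOut⇒~ p≢q
          (¬⟶⇒⟵ (y∉i ∘ flip trans p∈i) ¬y⟶p) (¬⟶⇒⟵ (y∉i ∘ flip trans q∈i) ¬y⟶q)))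
    where open NonadjacentPair P

  pair-outsiders : NonadjacentPair i p q → x ≢ y → x ≁ y → part x ≢ i → part y ≢ i →
                   (p ⟶ x × q ⟶ y) ⊎ (p ⟶ y × q ⟶ x)
  pair-outsiders {i} {p} {q} {x} {y} P x≢y x≁y x∉i y∉i = split (pair-in P x∉i) (pair-in P y∉i)
    where
    open NonadjacentPair P
    noCommon : x ⟶ w → y ⟶ w → ⊥
    noCommon x⟶w y⟶w = x≁y (commonOut⇒~ x≢y x⟶w y⟶w)
    from : part u ≡ i → part v ≢ i → ¬ v ⟶ u → u ⟶ v
    from u∈i v∉i = ¬⟶⇒⟵ (v∉i ∘ flip trans u∈i)
    split : x ⟶ p ⊎ x ⟶ q → y ⟶ p ⊎ y ⟶ q → (p ⟶ x × q ⟶ y) ⊎ (p ⟶ y × q ⟶ x)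
    split (inj₁ x⟶p) (inj₁ y⟶p) = ⊥-elim (noCommon x⟶p y⟶p)
    split (inj₂ x⟶q) (inj₂ y⟶q) = ⊥-elim (noCommon x⟶q y⟶q)
    split (inj₁ x⟶p) (inj₂ y⟶q) =
      inj₂ (from p∈i y∉i (noCommon x⟶p) , from q∈i x∉i (flip noCommon y⟶q))
    split (inj₂ x⟶q) (inj₁ y⟶p) =
      inj₁ (from p∈i x∉i (flip noCommon y⟶p) , from q∈i y∉i (noCommon x⟶q))

  pair-out⊆ : NonadjacentPair X c d → NonadjacentPair Y p q → X ≢ Y → N⁺ c ⊆ Y
  pair-out⊆ C P X≢Y c⟶z =
    [ (λ d⟶p → trans (pair-out-samePart C c⟶z d⟶p) p∈Y)
    , (λ d⟶q → trans (pair-out-samePart C c⟶z d⟶q) q∈Y)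
    ]′ (pair-in P (X≢Y ∘ trans (sym (NonadjacentPair.q∈i C))))
    where open NonadjacentPair P renaming (p∈i to p∈Y; q∈i to q∈Y)

  pair-outsider⊆ : NonadjacentPair X p q → NonadjacentPair Y p' q' → X ≢ Y →
                   x ≢ y → x ≁ y → part x ≢ X → part y ≢ X → part x ≡ Y
  pair-outsider⊆ P P' X≢Y x≢y x≁y x∉X y∉X =
    [ pair-out⊆ P P' X≢Y ∘ proj₁ , pair-out⊆ (swapPair P) P' X≢Y ∘ proj₂ ]′
      (pair-outsiders P x≢y x≁y x∉X y∉X)

  nonadjacent⇒inEither : NonadjacentPair X p q → NonadjacentPair Y p' q' → X ≢ Y →
                         x ≢ y → x ≁ y → part x ≡ X ⊎ part x ≡ Y
  nonadjacent⇒inEither {X} {Y = Y} {x = x} {y} P P' X≢Y x≢y x≁y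
    with part x ≟ X | part x ≟ Y | part y ≟ X
  ... | yes x∈X | _       | _       = inj₁ x∈X
  ... | no _    | yes x∈Y | _       = inj₂ x∈Y
  ... | no x∉X  | no x∉Y  | yes y∈X =
    ⊥-elim (x∉X (pair-outsider⊆ P' P (≢-sym X≢Y) x≢y x≁y x∉Y (X≢Y ∘ trans (sym y∈X))))
  ... | no x∉X  | no x∉Y  | no y∉X  = ⊥-elim (x∉Y (pair-outsider⊆ P P' X≢Y x≢y x≁y x∉X y∉X))

  pair⇒inEither : NonadjacentPair X p q → NonadjacentPair Y p' q' → X ≢ Y →
                  NonadjacentPair i x y → i ≡ X ⊎ i ≡ Y
  pair⇒inEither P P' X≢Y L =
    Sum.map (trans (sym p∈i)) (trans (sym p∈i)) (nonadjacent⇒inEither P P' X≢Y p≢q p≁q)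
    where open NonadjacentPair L

  outSingleton⇒⟶ : OutNbhdSingleton D u a → part z ≢ part u → z ≢ a → z ⟶ u
  outSingleton⇒⟶ (_ , only-a) z∉u z≢a = ¬⟶⇒⟵ (z∉u ∘ sym) (z≢a ∘ only-a _)

  outSingletons⇒unreached : OutNbhdSingleton D u a → OutNbhdSingleton D v b → a ≢ b → part a ≡ part b →
                            u ⟶ w → ¬ Reach≤2Avoiding D u v w
  outSingletons⇒unreached (_ , only-a) (_ , only-b) a≢b _ u⟶w (inj₁ v⟶w) =
    a≢b (trans (sym (only-a _ u⟶w)) (only-b _ v⟶w))
  outSingletons⇒unreached (_ , only-a) (_ , only-b) _ a≈b u⟶w (inj₂ (x , _ , v⟶x , x⟶w)) =
    ⟶⇒part≢ x⟶w (trans (cong part (only-b _ v⟶x)) (trans (sym a≈b) (cong part (sym (only-a _ u⟶w)))))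

  outSingletons⇒≁ : OutNbhdSingleton D u a → OutNbhdSingleton D v b → a ≢ b → part a ≡ part b → u ≁ v
  outSingletons⇒≁ N⁺u N⁺v a≢b a≈b (_ , _ , _ , _ , inj₁ (u⟶w , r)) =
    outSingletons⇒unreached N⁺u N⁺v a≢b a≈b u⟶w r
  outSingletons⇒≁ N⁺u N⁺v a≢b a≈b (_ , _ , _ , _ , inj₂ (v⟶w , r)) =
    outSingletons⇒unreached N⁺v N⁺u (≢-sym a≢b) (sym a≈b) v⟶w r

  outSingleton-⟶⇒≁ : OutNbhdSingleton D u a → a ⟶ v → N⁺ v ⊆ part a → u ≁ v
  outSingleton-⟶⇒≁ {v = v} (_ , only-a) a⟶v v⊆a (_ , _ , _ , _ , inj₁ (u⟶w , inj₁ v⟶w)) =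
    ⟶-asym a⟶v (subst (v ⟶_) (only-a _ u⟶w) v⟶w)
  outSingleton-⟶⇒≁ (_ , only-a) a⟶v v⊆a (_ , _ , _ , _ , inj₁ (u⟶w , inj₂ (_ , _ , v⟶x , x⟶w))) =
    ⟶⇒part≢ x⟶w (trans (v⊆a v⟶x) (cong part (sym (only-a _ u⟶w))))
  outSingleton-⟶⇒≁ {v = v} (_ , only-a) a⟶v v⊆a (_ , _ , _ , _ , inj₂ (v⟶w , inj₁ u⟶w)) =
    ⟶-asym a⟶v (subst (v ⟶_) (only-a _ u⟶w) v⟶w)
  outSingleton-⟶⇒≁ (_ , only-a) a⟶v v⊆a (_ , w , _ , _ , inj₂ (v⟶w , inj₂ (_ , _ , u⟶x , x⟶w))) =
    ⟶⇒part≢ (subst (_⟶ w) (only-a _ u⟶x) x⟶w) (sym (v⊆a v⟶w))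

  ⟶-≁⇒arcInto : u ⟶ v → u ≁ v → u ⟶ a → a ≢ v → v ⟶ b → z ≢ u → z ≢ v → z ⟶ u ⊎ z ⟶ v
  ⟶-≁⇒arcInto {u} {v} {z = z} u⟶v u≁v u⟶a a≢v v⟶b z≢u z≢v with z ⟶? u | z ⟶? v
  ... | yes z⟶u | _        = inj₁ z⟶u
  ... | no _     | yes z⟶v = inj₂ z⟶v
  ... | no ¬z⟶u | no ¬z⟶v with part z ≟ part u | part z ≟ part v
  ...   | yes z∈u | yes z∈v = ⊥-elim (⟶⇒part≢ u⟶v (trans (sym z∈u) z∈v))
  ...   | yes z∈u | no z∉v  = ⊥-elim (⟶⇒part≢ u⟶a (trans (sym z∈u)
          (sym (≁⇒out-samePart (⟶⇒≢ u⟶v) u≁v u⟶a (¬⟶⇒⟵ z∉v ¬z⟶v) a≢v z≢u))))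
  ...   | no z∉u  | yes z∈v = ⊥-elim (⟶⇒part≢ v⟶b (trans (sym z∈v)
          (≁⇒out-samePart (⟶⇒≢ u⟶v) u≁v (¬⟶⇒⟵ z∉u ¬z⟶u) v⟶b z≢v (≢-sym (⟶⟶⇒≢ u⟶v v⟶b)))))
  ...   | no z∉u  | no z∉v  = ⊥-elim (u≁v (commonOut⇒~ (⟶⇒≢ u⟶v) (¬⟶⇒⟵ z∉u ¬z⟶u) (¬⟶⇒⟵ z∉v ¬z⟶v)))

  arcInto⇒~ : u ⟶ v → x ≢ y → x ≢ u → y ≢ u → x ⟶ u ⊎ x ⟶ v → y ⟶ u ⊎ y ⟶ v → x ~ y
  arcInto⇒~ _   x≢y _   _   (inj₁ x⟶u) (inj₁ y⟶u) = commonOut⇒~ x≢y x⟶u y⟶u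
  arcInto⇒~ _   x≢y _   _   (inj₂ x⟶v) (inj₂ y⟶v) = commonOut⇒~ x≢y x⟶v y⟶v
  arcInto⇒~ u⟶v x≢y _   y≢u (inj₁ x⟶u) (inj₂ y⟶v) =
    ~-sym (twoPath⇒~ (≢-sym x≢y) y⟶v x⟶u u⟶v (≢-sym y≢u))
  arcInto⇒~ u⟶v x≢y x≢u _   (inj₂ x⟶v) (inj₁ y⟶u) =
    twoPath⇒~ x≢y x⟶v y⟶u u⟶v (≢-sym x≢u)

  record Hole (h0 h1 h2 h3 : Fin n) : Set where
    constructor mkHole
    field
      h0≢h1 : h0 ≢ h1
      h0≢h2 : h0 ≢ h2
      h0≢h3 : h0 ≢ h3
      h1≢h2 : h1 ≢ h2
      h1≢h3 : h1 ≢ h3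
      h2≢h3 : h2 ≢ h3
      h0~h1 : h0 ~ h1
      h1~h2 : h1 ~ h2
      h2~h3 : h2 ~ h3
      h3~h0 : h3 ~ h0
      h0≁h2 : h0 ≁ h2
      h1≁h3 : h1 ≁ h3

    vertices-unique : Unique (h0 ∷ h1 ∷ h2 ∷ h3 ∷ [])
    vertices-unique = (h0≢h1 ∷ h0≢h2 ∷ h0≢h3 ∷ []) ∷ (h1≢h2 ∷ h1≢h3 ∷ []) ∷ (h2≢h3 ∷ []) ∷ [] ∷ []

    pair02 : part h0 ≡ i → part h2 ≡ i → NonadjacentPair i h0 h2
    pair02 e0 e2 = record { p∈i = e0 ; q∈i = e2 ; p≢q = h0≢h2 ; p≁q = h0≁h2 }

    pair13 : part h1 ≡ i → part h3 ≡ i → NonadjacentPair i h1 h3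
    pair13 e1 e3 = record { p∈i = e1 ; q∈i = e3 ; p≢q = h1≢h3 ; p≁q = h1≁h3 }

  fromHole4 : Hole4 D h0 h1 h2 h3 → Hole h0 h1 h2 h3
  fromHole4 (h0≢h1 , h0≢h2 , h0≢h3 , h1≢h2 , h1≢h3 , h2≢h3 , h0~h1 , h1~h2 , h2~h3 , h3~h0 , h0≁h2 , h1≁h3) =
    mkHole h0≢h1 h0≢h2 h0≢h3 h1≢h2 h1≢h3 h2≢h3 h0~h1 h1~h2 h2~h3 h3~h0 h0≁h2 h1≁h3

  rotate : Hole h0 h1 h2 h3 → Hole h1 h2 h3 h0
  rotate H = record
    { h0≢h1 = h1≢h2 ; h0≢h2 = h1≢h3 ; h0≢h3 = ≢-sym h0≢h1
    ; h1≢h2 = h2≢h3 ; h1≢h3 = ≢-sym h0≢h2 ; h2≢h3 = ≢-sym h0≢h3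
    ; h0~h1 = h1~h2 ; h1~h2 = h2~h3 ; h2~h3 = h3~h0 ; h3~h0 = h0~h1
    ; h0≁h2 = h1≁h3 ; h1≁h3 = ≁-sym h0≁h2
    }
    where open Hole H

  reflect : Hole h0 h1 h2 h3 → Hole h0 h3 h2 h1
  reflect H = record
    { h0≢h1 = h0≢h3 ; h0≢h2 = h0≢h2 ; h0≢h3 = h0≢h1
    ; h1≢h2 = ≢-sym h2≢h3 ; h1≢h3 = ≢-sym h1≢h3 ; h2≢h3 = ≢-sym h1≢h2
    ; h0~h1 = ~-sym h3~h0 ; h1~h2 = ~-sym h2~h3 ; h2~h3 = ~-sym h1~h2 ; h3~h0 = ~-sym h0~h1
    ; h0≁h2 = h0≁h2 ; h1≁h3 = ≁-sym h1≁h3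
    }
    where open Hole H

  hole-⟶⇒outSingleton : Hole h0 h1 h2 h3 → h0 ⟶ h2 → OutNbhdSingleton D h0 h2
  hole-⟶⇒outSingleton {h0} {h1} {h2} {h3} H h0⟶h2 = h0⟶h2 , only-h2
    where
    open Hole H
    only-h2 : ∀ x → h0 ⟶ x → x ≡ h2
    only-h2 x h0⟶x = decidable-stable (x ≟ h2) λ x≢h2 → h1≁h3
      (arcInto⇒~ h0⟶h2 h1≢h3 (≢-sym h0≢h1) (≢-sym h0≢h3)
        (arcInto x≢h2 (≢-sym h0≢h1) h1≢h2) (arcInto x≢h2 (≢-sym h0≢h3) (≢-sym h2≢h3)))
      where
      arcInto : x ≢ h2 → z ≢ h0 → z ≢ h2 → z ⟶ h0 ⊎ z ⟶ h2
      arcInto x≢h2 = ⟶-≁⇒arcInto h0⟶h2 h0≁h2 h0⟶x x≢h2 (proj₁ (proj₂ (~⇒out-neighbour h2~h3)))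

  hole-part≢⇒outSingleton : Hole h0 h1 h2 h3 → part h0 ≢ part h2 →
                            OutNbhdSingleton D h0 h2 ⊎ OutNbhdSingleton D h2 h0
  hole-part≢⇒outSingleton H h0∉h2 =
    Sum.map (hole-⟶⇒outSingleton H) (hole-⟶⇒outSingleton (rotate (rotate H))) (diffArc _ _ h0∉h2)

  hole⊆part⇒4≤ : Hole h0 h1 h2 h3 → part h0 ≡ i → part h1 ≡ i → part h2 ≡ i → part h3 ≡ i → 4 ≤ partSize D i
  hole⊆part⇒4≤ H e0 e1 e2 e3 = Unique⇒≤partSize (Hole.vertices-unique H) (e0 ∷ e1 ∷ e2 ∷ e3 ∷ [])

  Cyclic : Fin n → Fin n → Fin n → Fin n → Set
  Cyclic h0 h1 h2 h3 = h0 ⟶ h1 × h1 ⟶ h2 × h2 ⟶ h3 × h3 ⟶ h0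

  hole-bipartite⇒cyclic : Hole h0 h1 h2 h3 → part h0 ≡ part h2 → part h1 ≡ i → part h3 ≡ i → part h0 ≢ i →
                          Cyclic h0 h1 h2 h3 ⊎ Cyclic h0 h3 h2 h1
  hole-bipartite⇒cyclic {h0} {h1} {h2} {h3} H e02 e1 e3 h0∉i =
    orient (pair-in (pair13 e1 e3) h0∉i) (pair-in (pair13 e1 e3) (h0∉i ∘ trans e02))
    where
    open Hole H
    noCommon : h0 ⟶ y → h2 ⟶ y → ⊥
    noCommon h0⟶y h2⟶y = h0≁h2 (commonOut⇒~ h0≢h2 h0⟶y h2⟶y)
    h0∉h1 : part h0 ≢ part h1
    h0∉h1 = h0∉i ∘ flip trans e1
    h0∉h3 : part h0 ≢ part h3
    h0∉h3 = h0∉i ∘ flip trans e3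
    orient : h0 ⟶ h1 ⊎ h0 ⟶ h3 → h2 ⟶ h1 ⊎ h2 ⟶ h3 → Cyclic h0 h1 h2 h3 ⊎ Cyclic h0 h3 h2 h1
    orient (inj₁ h0⟶h1) (inj₁ h2⟶h1) = ⊥-elim (noCommon h0⟶h1 h2⟶h1)
    orient (inj₂ h0⟶h3) (inj₂ h2⟶h3) = ⊥-elim (noCommon h0⟶h3 h2⟶h3)
    orient (inj₁ h0⟶h1) (inj₂ h2⟶h3) =
      inj₁ (h0⟶h1 , ¬⟶⇒⟵ (h0∉h1 ∘ trans e02) (noCommon h0⟶h1) ,
            h2⟶h3 , ¬⟶⇒⟵ h0∉h3 (flip noCommon h2⟶h3))
    orient (inj₂ h0⟶h3) (inj₁ h2⟶h1) =
      inj₂ (h0⟶h3 , ¬⟶⇒⟵ (h0∉h3 ∘ trans e02) (noCommon h0⟶h3) ,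
            h2⟶h1 , ¬⟶⇒⟵ h0∉h1 (flip noCommon h2⟶h1))

  hole-cyclic⇒4≤ : Hole h0 h1 h2 h3 → Cyclic h0 h1 h2 h3 → part h0 ≡ part h2 → part h1 ≡ i → part h3 ≡ i →
                   4 ≤ partSize D i
  hole-cyclic⇒4≤ {h0} {h1} {h2} {h3} {i} H (h0⟶h1 , h1⟶h2 , h2⟶h3 , h3⟶h0) e02 e1 e3
    with ~⇒out-neighbour (Hole.h0~h1 H) | ~⇒out-neighbour (Hole.h2~h3 H)
  ... | q , h0⟶q , q≢h1 | q' , h2⟶q' , q'≢h3 = Unique⇒≤partSize distinct (e1 ∷ e3 ∷ q∈i ∷ q'∈i ∷ [])
    where
    open Hole H
    P02 : NonadjacentPair (part h0) h0 h2
    P02 = pair02 refl (sym e02)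
    q∈i : part q ≡ i
    q∈i = trans (pair-out-samePart P02 h0⟶q h2⟶h3) e3
    q'∈i : part q' ≡ i
    q'∈i = trans (pair-out-samePart (swapPair P02) h2⟶q' h0⟶h1) e1
    distinct : Unique (h1 ∷ h3 ∷ q ∷ q' ∷ [])
    distinct = (h1≢h3 ∷ ≢-sym q≢h1 ∷ ⟶⟶⇒≢ h1⟶h2 h2⟶q' ∷ [])
             ∷ (⟶⟶⇒≢ h3⟶h0 h0⟶q ∷ ≢-sym q'≢h3 ∷ [])
             ∷ ((λ { refl → h0≁h2 (commonOut⇒~ h0≢h2 h0⟶q h2⟶q') }) ∷ [])
             ∷ [] ∷ []

  hole-bipartite⇒4≤ : Hole h0 h1 h2 h3 → part h0 ≡ part h2 → part h1 ≡ i → part h3 ≡ i → part h0 ≢ i →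
                      4 ≤ partSize D i
  hole-bipartite⇒4≤ H e02 e1 e3 h0∉i =
    [ (λ cyc → hole-cyclic⇒4≤ H cyc e02 e1 e3) , (λ cyc → hole-cyclic⇒4≤ (reflect H) cyc e02 e3 e1) ]′
      (hole-bipartite⇒cyclic H e02 e1 e3 h0∉i)

  hole-bipartite⇒∃4≤ : Hole h0 h1 h2 h3 → part h0 ≡ part h2 → part h1 ≡ part h3 → ∃ λ i → 4 ≤ partSize D i
  hole-bipartite⇒∃4≤ {h0} {h1} H e02 e13 with part h0 ≟ part h1
  ... | yes e01 = part h0 , hole⊆part⇒4≤ H refl (sym e01) (sym e02) (sym (trans e01 e13))
  ... | no h0∉h1 = part h1 , hole-bipartite⇒4≤ H e02 refl (sym e13) h0∉h1

  hole-twoSources⇒4≤ : NonadjacentPair X p q → Y ≢ X → Hole h0 h1 h2 h3 →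
                       part h0 ≡ Y → part h1 ≡ Y → part h2 ≡ Y → part h3 ≡ Y →
                       p ⟶ h0 → p ⟶ h1 → q ⟶ h2 → q ⟶ h3 → 4 ≤ partSize D X
  hole-twoSources⇒4≤ {X} {p} {q} {Y} {h0} {h1} {h2} {h3} P Y≢X H e0 e1 e2 e3 p⟶h0 p⟶h1 q⟶h2 q⟶h3 =
    count (~⇒commonOut h1~h2 (out⊆X (pair13 e1 e3)) (out⊆X (swapPair (pair02 e0 e2))))
          (~⇒commonOut h3~h0 (out⊆X (swapPair (pair13 e1 e3))) (out⊆X (pair02 e0 e2)))
    where
    open Hole H
    open NonadjacentPair P using (p≢q) renaming (p∈i to p∈X; q∈i to q∈X)
    out⊆X : NonadjacentPair Y u v → N⁺ u ⊆ X
    out⊆X Q = pair-out⊆ Q P Y≢X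
    count : (∃ λ w → h1 ⟶ w × h2 ⟶ w) → (∃ λ w' → h3 ⟶ w' × h0 ⟶ w') → 4 ≤ partSize D X
    count (w , h1⟶w , h2⟶w) (w' , h3⟶w' , h0⟶w') =
      Unique⇒≤partSize distinct
        (p∈X ∷ q∈X ∷ out⊆X (pair13 e1 e3) h1⟶w ∷ out⊆X (pair02 e0 e2) h0⟶w' ∷ [])
      where
      distinct : Unique (p ∷ q ∷ w ∷ w' ∷ [])
      distinct = (p≢q ∷ ⟶⟶⇒≢ p⟶h1 h1⟶w ∷ ⟶⟶⇒≢ p⟶h0 h0⟶w' ∷ [])
               ∷ (⟶⟶⇒≢ q⟶h2 h2⟶w ∷ ⟶⟶⇒≢ q⟶h3 h3⟶w' ∷ [])
               ∷ ((λ { refl → h0≁h2 (commonOut⇒~ h0≢h2 h0⟶w' h2⟶w) }) ∷ [])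
               ∷ [] ∷ []

  hole⊆otherPart⇒4≤ : NonadjacentPair X p q → Y ≢ X → Hole h0 h1 h2 h3 →
                          part h0 ≡ Y → part h1 ≡ Y → part h2 ≡ Y → part h3 ≡ Y → 4 ≤ partSize D X
  hole⊆otherPart⇒4≤ {X} {p} {q} {Y} {h0} {h1} {h2} {h3} P Y≢X H e0 e1 e2 e3 =
    sources (outsiders h0≢h2 h0≁h2 e0 e2) (outsiders h1≢h3 h1≁h3 e1 e3)
    where
    open Hole H
    outsiders : x ≢ y → x ≁ y → part x ≡ Y → part y ≡ Y → (p ⟶ x × q ⟶ y) ⊎ (p ⟶ y × q ⟶ x)
    outsiders x≢y x≁y x∈Y y∈Y = pair-outsiders P x≢y x≁y (Y≢X ∘ trans (sym x∈Y)) (Y≢X ∘ trans (sym y∈Y))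
    sources : (p ⟶ h0 × q ⟶ h2) ⊎ (p ⟶ h2 × q ⟶ h0) → (p ⟶ h1 × q ⟶ h3) ⊎ (p ⟶ h3 × q ⟶ h1) →
              4 ≤ partSize D X
    sources (inj₁ (p⟶h0 , q⟶h2)) (inj₁ (p⟶h1 , q⟶h3)) =
      hole-twoSources⇒4≤ P Y≢X H e0 e1 e2 e3 p⟶h0 p⟶h1 q⟶h2 q⟶h3
    sources (inj₂ (p⟶h2 , q⟶h0)) (inj₁ (p⟶h1 , q⟶h3)) =
      hole-twoSources⇒4≤ P Y≢X (rotate H) e1 e2 e3 e0 p⟶h1 p⟶h2 q⟶h3 q⟶h0
    sources (inj₂ (p⟶h2 , q⟶h0)) (inj₂ (p⟶h3 , q⟶h1)) =
      hole-twoSources⇒4≤ P Y≢X (rotate (rotate H)) e2 e3 e0 e1 p⟶h2 p⟶h3 q⟶h0 q⟶h1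
    sources (inj₁ (p⟶h0 , q⟶h2)) (inj₂ (p⟶h3 , q⟶h1)) =
      hole-twoSources⇒4≤ P Y≢X (rotate (rotate (rotate H))) e3 e0 e1 e2 p⟶h3 p⟶h0 q⟶h1 q⟶h2

  hole-outSingleton⇒part≡ : Hole h0 h1 h2 h3 → OutNbhdSingleton D h0 h2 →
                            part h2 ≡ part h3 → part h0 ≢ part h3 → part h1 ≡ part h3
  hole-outSingleton⇒part≡ {h0} {h1} {h2} {h3} H N⁺h0 e23 h0∉h3 =
    decidable-stable (part h1 ≟ part h3) λ h1∉h3 →
    [ (λ N⁺h1 → outSingletons⇒≁ N⁺h0 N⁺h1 h2≢h3 e23 h0~h1)
    , (λ N⁺h3 → h0≢h1 (proj₂ N⁺h3 h0 (outSingleton⇒⟶ N⁺h0 (h0∉h3 ∘ sym) (≢-sym h2≢h3))))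
    ]′ (hole-part≢⇒outSingleton (rotate H) h1∉h3)
    where open Hole H

  hole-inEither : NonadjacentPair X p q → NonadjacentPair Y p' q' → X ≢ Y → Hole h0 h1 h2 h3 →
                  part h0 ≡ X ⊎ part h0 ≡ Y
  hole-inEither P P' X≢Y H = nonadjacent⇒inEither P P' X≢Y (Hole.h0≢h2 H) (Hole.h0≁h2 H)

  noSplitHole-outSingleton : NonadjacentPair X p q → NonadjacentPair Y p' q' → X ≢ Y → Hole h0 h1 h2 h3 →
                             OutNbhdSingleton D h0 h2 → part h0 ≡ X → part h2 ≡ Y → ⊥
  noSplitHole-outSingleton {X} {Y = Y} {h0 = h0} {h1} {h2} {h3} P P' X≢Y H N⁺h0 e0 e2 =
    place (hole-inEither P P' X≢Y (rotate H)) (hole-inEither P P' X≢Y (rotate (rotate (rotate H))))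
    where
    open Hole H
    X∉ : part z ≡ Y → part h0 ≢ part z
    X∉ z∈Y h0≈z = X≢Y (trans (sym e0) (trans h0≈z z∈Y))
    arcToH0 : part z ≡ Y → z ≢ h2 → z ⟶ h0
    arcToH0 z∈Y = outSingleton⇒⟶ N⁺h0 (X∉ z∈Y ∘ sym)
    out⊆h2 : NonadjacentPair X u v → N⁺ u ⊆ part h2
    out⊆h2 Q u⟶z = trans (pair-out⊆ Q P' X≢Y u⟶z) (sym e2)
    place : part h1 ≡ X ⊎ part h1 ≡ Y → part h3 ≡ X ⊎ part h3 ≡ Y → ⊥
    place (inj₁ e1) (inj₁ e3) =
      [ (λ h2⟶h1 → outSingleton-⟶⇒≁ N⁺h0 h2⟶h1 (out⊆h2 (pair13 e1 e3)) h0~h1)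
      , (λ h2⟶h3 → outSingleton-⟶⇒≁ N⁺h0 h2⟶h3 (out⊆h2 (swapPair (pair13 e1 e3))) (~-sym h3~h0))
      ]′ (pair-in (pair13 e1 e3) (X≢Y ∘ sym ∘ trans (sym e2)))
    place (inj₂ e1) (inj₂ e3) = h1≁h3 (commonOut⇒~ h1≢h3 (arcToH0 e1 h1≢h2) (arcToH0 e3 (≢-sym h2≢h3)))
    place (inj₁ e1) (inj₂ e3) =
      X≢Y (trans (sym e1)
        (trans (hole-outSingleton⇒part≡ H N⁺h0 (trans e2 (sym e3)) (X∉ e3)) e3))
    place (inj₂ e1) (inj₁ e3) =
      X≢Y (trans (sym e3)
        (trans (hole-outSingleton⇒part≡ (reflect H) N⁺h0 (trans e2 (sym e1)) (X∉ e1)) e1))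

  noSplitHole : NonadjacentPair X p q → NonadjacentPair Y p' q' → X ≢ Y → Hole h0 h1 h2 h3 →
                part h0 ≡ X → part h2 ≡ Y → ⊥
  noSplitHole P P' X≢Y H e0 e2 =
    [ (λ N⁺h0 → noSplitHole-outSingleton P P' X≢Y H N⁺h0 e0 e2)
    , (λ N⁺h2 → noSplitHole-outSingleton P' P (≢-sym X≢Y) (rotate (rotate H)) N⁺h2 e2 e0)
    ]′ (hole-part≢⇒outSingleton H λ h0≈h2 → X≢Y (trans (sym e0) (trans h0≈h2 e2)))

  hole-opposite-samePart : NonadjacentPair X p q → NonadjacentPair Y p' q' → X ≢ Y → Hole h0 h1 h2 h3 →
                           part h0 ≡ part h2
  hole-opposite-samePart {X} {Y = Y} {h0 = h0} {h2 = h2} P P' X≢Y H =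
    place (hole-inEither P P' X≢Y H) (hole-inEither P P' X≢Y (rotate (rotate H)))
    where
    open Hole H
    place : part h0 ≡ X ⊎ part h0 ≡ Y → part h2 ≡ X ⊎ part h2 ≡ Y → part h0 ≡ part h2
    place (inj₁ e0) (inj₁ e2) = trans e0 (sym e2)
    place (inj₂ e0) (inj₂ e2) = trans e0 (sym e2)
    place (inj₁ e0) (inj₂ e2) = ⊥-elim (noSplitHole P P' X≢Y H e0 e2)
    place (inj₂ e0) (inj₁ e2) = ⊥-elim (noSplitHole P' P (≢-sym X≢Y) H e0 e2)

  twoNonCompeting-hole⇒4≤ : NonadjacentPair X p q → NonadjacentPair Y p' q' → X ≢ Y → Hole h0 h1 h2 h3 →
                            4 ≤ partSize D X
  twoNonCompeting-hole⇒4≤ {X} {Y = Y} {h0 = h0} {h1} {h2} {h3} P P' X≢Y H =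
    place (hole-inEither P P' X≢Y H) (hole-inEither P P' X≢Y (rotate H))
    where
    open Hole H
    e02 : part h0 ≡ part h2
    e02 = hole-opposite-samePart P P' X≢Y H
    e13 : part h1 ≡ part h3
    e13 = hole-opposite-samePart P P' X≢Y (rotate H)
    ∉X : part z ≡ Y → part z ≢ X
    ∉X z∈Y z∈X = X≢Y (trans (sym z∈X) z∈Y)
    place : part h0 ≡ X ⊎ part h0 ≡ Y → part h1 ≡ X ⊎ part h1 ≡ Y → 4 ≤ partSize D X
    place (inj₁ e0) (inj₁ e1) = hole⊆part⇒4≤ H e0 e1 (trans (sym e02) e0) (trans (sym e13) e1)
    place (inj₁ e0) (inj₂ e1) = hole-bipartite⇒4≤ (rotate H) e13 (trans (sym e02) e0) e0 (∉X e1)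
    place (inj₂ e0) (inj₁ e1) = hole-bipartite⇒4≤ H e02 e1 (trans (sym e13) e1) (∉X e0)
    place (inj₂ e0) (inj₂ e1) =
      hole⊆otherPart⇒4≤ P (≢-sym X≢Y) H e0 e1 (trans (sym e02) e0) (trans (sym e13) e1)

  nonCompetingParts : (X : Fin k) → ¬ Competing D X → Hole h0 h1 h2 h3 →
    ((∀ (j : Fin k) → ¬ Competing D j → j ≡ X)
      ⊎ (4 ≤ partSize D X × Σ (Fin k) (λ j → j ≢ X × ¬ Competing D j × 4 ≤ partSize D j ×
           (∀ (l : Fin k) → l ≢ X → ¬ Competing D l → l ≡ j))))
  nonCompetingParts X ¬compX H with any? (λ j → ¬? (j ≟ X) ×-dec ¬? (competing? j))
  ... | no none = inj₁ λ j ¬compj → decidable-stable (j ≟ X) λ j≢X → none (j , j≢X , ¬compj)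
  ... | yes (j , j≢X , ¬compj) with ¬competing⇒pair ¬compX | ¬competing⇒pair ¬compj
  ...   | _ , _ , P | _ , _ , P' =
    inj₂ ( twoNonCompeting-hole⇒4≤ P P' (≢-sym j≢X) H
         , j , j≢X , ¬compj , twoNonCompeting-hole⇒4≤ P' P j≢X H , only-j )
    where
    only-j : ∀ l → l ≢ X → ¬ Competing D l → l ≡ j
    only-j l l≢X ¬compl = decidable-stable (l ≟ j) λ l≢j →
      [ l≢X , l≢j ]′ (pair⇒inEither P P' (≢-sym j≢X) (proj₂ (proj₂ (¬competing⇒pair ¬compl))))

theorem4p6 : ∀ {n k : ℕ} (D : MPT n k) → Loose D →
    (X : Fin k) → ¬ Competing D X →
    (v0 v1 v2 v3 : Fin n) → Hole4 D v0 v1 v2 v3 →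
    ((∀ (j : Fin k) → ¬ Competing D j → j ≡ X)
      ⊎ (4 ≤ partSize D X × Σ (Fin k) (λ j → j ≢ X × ¬ Competing D j × 4 ≤ partSize D j ×
           (∀ (l : Fin k) → l ≢ X → ¬ Competing D l → l ≡ j))))
    × ((MPT.part D v0 ≢ MPT.part D v2 → OutNbhdSingleton D v0 v2 ⊎ OutNbhdSingleton D v2 v0)
      × (MPT.part D v1 ≢ MPT.part D v3 → OutNbhdSingleton D v1 v3 ⊎ OutNbhdSingleton D v3 v1)
      × (MPT.part D v0 ≡ MPT.part D v2 → MPT.part D v1 ≡ MPT.part D v3 →
           Σ (Fin k) (λ i → 4 ≤ partSize D i)))
theorem4p6 D _ X ¬compX v0 v1 v2 v3 hole =
  nonCompetingParts D X ¬compX H ,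
  hole-part≢⇒outSingleton D H ,
  hole-part≢⇒outSingleton D (rotate D H) ,
  hole-bipartite⇒∃4≤ D H
  where
  H : Hole D v0 v1 v2 v3
  H = fromHole4 D hole
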